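{- Let $R$ be an integral domain and let $p$ be a prime of $R$. Let $\underline u=(u_1,\ldots,u_r)$ ($r\geq 1$) be a tuple of variables and let $P\in R[\underline u,y]$ be a polynomial not divisible by $p$ (in $R[\underline u,y]$). Let $m(\underline u)\in R[\underline u]$ be a polynomial having two distinct monomials $m_1(\underline u)$, $m_2(\underline u)$, with respective coefficients $\mu_1,\mu_2\in R$ in $m$, such that (i) $\mu_2\equiv 1\pmod{\mu_1}$, and (ii) $\min(\deg m_1,\deg m_2)>\deg_{\underline u}(P)$. Then $P(\underline u,m(\underline u))$ is not divisible by $p$ in $R[\underline u]$.
   Context: A prime of $R$ is an element $p\in R$ such that $pR$ is a nonzero prime ideal. Degrees of monomials in $\underline u$ are total degrees, and $\deg_{\underline u}(P)$ is the total degree of $P$ in the variables $\underline u$. -}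

module Defs where

open import Level using (Level; _⊔_)
open import Algebra.Bundles using (CommutativeRing)
open import Data.Nat as ℕ using (ℕ; zero; suc; _<_)
open import Data.Vec using (Vec; []; _∷_; zipWith; replicate)
open import Data.Vec.Properties using (≡-dec)
open import Data.List using (List; []; _∷_; map; concatMap; foldr)
open import Data.Product using (_×_; _,_; ∃)
open import Data.Sum using (_⊎_)
open import Relation.Nullary using (¬_; yes; no)
open import Relation.Binary.PropositionalEquality using (_≡_)

totalDeg : ∀ {n} → Vec ℕ n → ℕ
totalDeg [] = 0
totalDeg (e ∷ es) = e ℕ.+ totalDeg es

module _ {c ℓ} (R : CommutativeRing c ℓ) where
  open CommutativeRing R renaming (Carrier to A)

  _∣R_ : A → A → Set (c ⊔ ℓ)
  a ∣R b = ∃ λ q → b ≈ a * q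

  record IsIntegralDomain : Set (c ⊔ ℓ) where
    field
      1≉0      : ¬ (1# ≈ 0#)
      noZeroDiv : ∀ x y → x * y ≈ 0# → x ≈ 0# ⊎ y ≈ 0#

  record IsPrimeElement (p : A) : Set (c ⊔ ℓ) where
    field
      nonzero  : ¬ (p ≈ 0#)
      proper   : ¬ (p ∣R 1#)
      primeIdl : ∀ a b → p ∣R (a * b) → p ∣R a ⊎ p ∣R b

  -- Polynomials in n variables over R, as finite formal sums of terms
  -- (coefficient, exponent vector).  Equality is coefficientwise.
  Poly : ℕ → Set c
  Poly n = List (A × Vec ℕ n)

  coeff : ∀ {n} → Poly n → Vec ℕ n → A
  coeff [] e = 0#
  coeff ((a , f) ∷ P) e with ≡-dec ℕ._≟_ f e
  ... | yes _ = a + coeff P e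
  ... | no  _ = coeff P e

  _≈ₚ_ : ∀ {n} → Poly n → Poly n → Set ℓ
  P ≈ₚ Q = ∀ e → coeff P e ≈ coeff Q e

  oneₚ : ∀ {n} → Poly n
  oneₚ {n} = (1# , replicate n 0) ∷ []

  scaleₚ : ∀ {n} → A → Poly n → Poly n
  scaleₚ a P = map (λ { (b , e) → (a * b , e) }) P

  _*ₚ_ : ∀ {n} → Poly n → Poly n → Poly n
  P *ₚ Q = concatMap (λ { (a , e) → map (λ { (b , f) → (a * b , zipWith ℕ._+_ e f) }) Q }) P

  _^ₚ_ : ∀ {n} → Poly n → ℕ → Poly n
  P ^ₚ zero = oneₚ
  P ^ₚ suc k = P *ₚ (P ^ₚ k)

  _∣ₚ_ : ∀ {n} → A → Poly n → Set (c ⊔ ℓ)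
  a ∣ₚ P = ∃ λ Q → P ≈ₚ scaleₚ a Q

  -- R[u, y] with u = (u_1..u_r): exponent vectors k ∷ a, k the exponent of y.
  -- Substitution y ↦ m(u): P(u, m(u)).
  substY : ∀ {r} → Poly (suc r) → Poly r → Poly r
  substY P m = concatMap (λ { (a , k ∷ e) → ((a , e) ∷ []) *ₚ (m ^ₚ k) }) P

  degU< : ∀ {r} → Poly (suc r) → ℕ → Set ℓ
  degU< P d = ∀ k e → ¬ (coeff P (k ∷ e) ≈ 0#) → totalDeg e < d

-- Reduce modulo p: R/pR is an integral domain, and as μ₂ ≡ 1 (mod μ₁) the coefficients μ₁, μ₂
-- cannot both vanish there, so m has a monomial u^e, nonzero mod p, with deg_u P < deg e.
-- Over a domain, write P = P(u, 0) + y · P₁, so that P(u, m) = P(u, 0) + m · P₁(u, m). If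
-- P₁(u, m) ≠ 0, the product of the graded-lex leading terms of m and P₁(u, m) has total degree
-- ≥ deg e > deg_u P, so P(u, 0) cannot cancel it; hence P₁(u, m) = 0, by induction on the
-- y-degree P₁ = 0, and then P(u, 0) = P(u, m) = 0. Vanishing of a coefficient is undecidable,
-- so leading terms exist only under double negation, which suffices since the goal is a negation.
module Submission where

open import Defs
open import Algebra.Bundles using (CommutativeRing)
open import Data.Empty using (⊥; ⊥-elim)
open import Data.List using (List; []; _∷_; _++_; map; deduplicate)
open import Data.List.Membership.Propositional using (_∈_; _∉_)
open import Data.List.Membership.Propositional.Properties using (∈-deduplicate⁺)
open import Data.List.Properties using (++-assoc)
open import Data.List.Relation.Unary.All as All using (All; []; _∷_)
open import Data.List.Relation.Unary.All.Properties using (All¬⇒¬Any)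
open import Data.List.Relation.Unary.Any using (here; there)
open import Data.List.Relation.Unary.Unique.Propositional using (Unique; []; _∷_)
open import Data.Nat as ℕ using (ℕ; zero; suc)
import Data.Nat.Properties as ℕ
open import Algebra.Properties.CommutativeSemigroup ℕ.+-commutativeSemigroup using ()
  renaming (interchange to ℕ-+-interchange)
open import Data.Product using (_×_; _,_; ∃; ∃-syntax; proj₁; proj₂)
open import Data.Product.Relation.Binary.Lex.Strict using (×-Lex; ×-transitive; ×-compare)
open import Data.Sum as Sum using (_⊎_; inj₁; inj₂; [_,_])
open import Data.Vec using (Vec; []; _∷_; zipWith; replicate)
open import Data.Vec.Properties using (≡-dec; zipWith-comm; zipWith-assoc; zipWith-identityʳ; ∷-injective)
import Data.Vec.Relation.Binary.Lex.Strict as Lex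
open Lex using (Lex-<; this; next)
open import Data.Vec.Relation.Binary.Pointwise.Inductive using (Pointwise-≡⇒≡; ≡⇒Pointwise-≡)
open import Effect.Monad using (RawMonad)
open import Function using (_∘_; _on_; case_of_)
open import Level using (0ℓ; _⊔_)
open import Relation.Binary using (Rel; IsEquivalence; Trichotomous; Transitive; tri<; tri≈; tri>)
open import Relation.Binary.PropositionalEquality as ≡ using (_≡_; _≢_)
open import Relation.Nullary using (¬_; Dec; yes; no; contradiction; ¬¬-excluded-middle)
open import Relation.Nullary.Negation using (¬¬-Monad)

infixl 6 _+ᵥ_
_+ᵥ_ : ∀ {n} → Vec ℕ n → Vec ℕ n → Vec ℕ n
_+ᵥ_ = zipWith ℕ._+_

+ᵥ-comm : ∀ {n} (a b : Vec ℕ n) → a +ᵥ b ≡ b +ᵥ a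
+ᵥ-comm = zipWith-comm ℕ.+-comm

+ᵥ-assoc : ∀ {n} (a b c : Vec ℕ n) → (a +ᵥ b) +ᵥ c ≡ a +ᵥ (b +ᵥ c)
+ᵥ-assoc = zipWith-assoc ℕ.+-assoc

+ᵥ-identityʳ : ∀ {n} (a : Vec ℕ n) → a +ᵥ replicate n 0 ≡ a
+ᵥ-identityʳ = zipWith-identityʳ ℕ.+-identityʳ

+ᵥ-exchange : ∀ {n} (a b c : Vec ℕ n) → a +ᵥ (b +ᵥ c) ≡ b +ᵥ (a +ᵥ c)
+ᵥ-exchange a b c =
  ≡.trans (≡.sym (+ᵥ-assoc a b c)) (≡.trans (≡.cong (_+ᵥ c) (+ᵥ-comm a b)) (+ᵥ-assoc b a c))

+ᵥ-cancelˡ : ∀ {n} (a : Vec ℕ n) {b c} → a +ᵥ b ≡ a +ᵥ c → b ≡ c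
+ᵥ-cancelˡ [] {[]} {[]} _ = ≡.refl
+ᵥ-cancelˡ (x ∷ a) {_ ∷ _} {_ ∷ _} eq =
  ≡.cong₂ _∷_ (ℕ.+-cancelˡ-≡ x _ _ (proj₁ (∷-injective eq))) (+ᵥ-cancelˡ a (proj₂ (∷-injective eq)))

totalDeg-+ᵥ : ∀ {n} (a b : Vec ℕ n) → totalDeg (a +ᵥ b) ≡ totalDeg a ℕ.+ totalDeg b
totalDeg-+ᵥ [] [] = ≡.refl
totalDeg-+ᵥ (x ∷ a) (y ∷ b) =
  ≡.trans (≡.cong (x ℕ.+ y ℕ.+_) (totalDeg-+ᵥ a b)) (ℕ-+-interchange x y _ _)

module _ {n : ℕ} where

  infix 4 _<ₗ_ _<ₘ_
  _<ₗ_ : Rel (Vec ℕ n) 0ℓ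
  _<ₗ_ = Lex-< _≡_ ℕ._<_

  _<ₘ_ : Rel (Vec ℕ n) 0ℓ
  _<ₘ_ = ×-Lex _≡_ ℕ._<_ _<ₗ_ on (λ a → totalDeg a , a)

  <ₘ-irrefl : ∀ {a} → ¬ a <ₘ a
  <ₘ-irrefl (inj₁ d<d) = ℕ.<-irrefl ≡.refl d<d
  <ₘ-irrefl (inj₂ (_ , a<a)) = Lex.<-irrefl ℕ.<-irrefl (≡⇒Pointwise-≡ ≡.refl) a<a

  <ₗ-trans : Transitive _<ₗ_
  <ₗ-trans = Lex.<-trans (IsEquivalence.isPartialEquivalence ≡.isEquivalence) ℕ.<-resp₂-≡ ℕ.<-trans
               {n} {n} {n}

  <ₘ-trans : Transitive _<ₘ_
  <ₘ-trans {a} {b} {c} = ×-transitive {_<₂_ = _<ₗ_} ≡.isEquivalence ℕ.<-resp₂-≡ ℕ.<-trans <ₗ-trans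
                           {totalDeg a , a} {totalDeg b , b} {totalDeg c , c}

  <ₘ-cmp : Trichotomous _≡_ _<ₘ_
  <ₘ-cmp a b with ×-compare ≡.sym ℕ.<-cmp (Lex.<-cmp ≡.sym ℕ.<-cmp) (totalDeg a , a) (totalDeg b , b)
  ... | tri< a<b a≢b a≯b = tri< a<b (λ { ≡.refl → a≢b (≡.refl , ≡⇒Pointwise-≡ ≡.refl) }) a≯b
  ... | tri≈ a≮b (_ , a≋b) a≯b = tri≈ a≮b (Pointwise-≡⇒≡ a≋b) a≯b
  ... | tri> a≮b a≢b a>b = tri> a≮b (λ { ≡.refl → a≢b (≡.refl , ≡⇒Pointwise-≡ ≡.refl) }) a>b

<ₗ-+ᵥ-monoˡ : ∀ {n} {a b : Vec ℕ n} c → a <ₗ b → a +ᵥ c <ₗ b +ᵥ c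
<ₗ-+ᵥ-monoˡ (z ∷ c) (this x<y ≡.refl) = this (ℕ.+-monoˡ-< z x<y) ≡.refl
<ₗ-+ᵥ-monoˡ (z ∷ c) (next ≡.refl a<b) = next ≡.refl (<ₗ-+ᵥ-monoˡ c a<b)

module _ {n : ℕ} where

  <ₘ-+ᵥ-monoˡ : ∀ {a b : Vec ℕ n} c → a <ₘ b → a +ᵥ c <ₘ b +ᵥ c
  <ₘ-+ᵥ-monoˡ {a} {b} c a<b rewrite totalDeg-+ᵥ a c | totalDeg-+ᵥ b c with a<b
  ... | inj₁ da<db = inj₁ (ℕ.+-monoˡ-< (totalDeg c) da<db)
  ... | inj₂ (da≡db , a<ₗb) = inj₂ (≡.cong (ℕ._+ totalDeg c) da≡db , <ₗ-+ᵥ-monoˡ c a<ₗb)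

  <ₘ-+ᵥ-monoʳ : ∀ {a b : Vec ℕ n} c → a <ₘ b → c +ᵥ a <ₘ c +ᵥ b
  <ₘ-+ᵥ-monoʳ {a} {b} c a<b rewrite +ᵥ-comm c a | +ᵥ-comm c b = <ₘ-+ᵥ-monoˡ c a<b

  <ₘ-+ᵥ-cancel : ∀ {f e e′ g : Vec ℕ n} → f <ₘ e → f +ᵥ g ≡ e +ᵥ e′ → e′ <ₘ g
  <ₘ-+ᵥ-cancel {f} {e} {e′} {g} f<e eq with <ₘ-cmp e′ g
  ... | tri< e′<g _ _ = e′<g
  ... | tri≈ _ ≡.refl _ = ⊥-elim (<ₘ-irrefl (≡.subst (_<ₘ e +ᵥ e′) eq (<ₘ-+ᵥ-monoˡ e′ f<e)))
  ... | tri> _ _ g<e′ = ⊥-elim (<ₘ-irrefl (≡.subst (_<ₘ e +ᵥ e′) eq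
                          (<ₘ-trans (<ₘ-+ᵥ-monoˡ g f<e) (<ₘ-+ᵥ-monoʳ e g<e′))))

  ≯ₘ⇒totalDeg≤ : ∀ {a b : Vec ℕ n} → ¬ b <ₘ a → totalDeg a ℕ.≤ totalDeg b
  ≯ₘ⇒totalDeg≤ b≮a = ℕ.≮⇒≥ (λ db<da → b≮a (inj₁ db<da))

module Pairing {c ℓ} (K : CommutativeRing c ℓ) where

  open CommutativeRing K renaming (Carrier to A)
  open import Relation.Binary.Reasoning.Setoid setoid
  open import Algebra.Properties.CommutativeSemigroup +-commutativeSemigroup using (interchange; x∙yz≈y∙xz)
  open import Algebra.Properties.CommutativeSemigroup *-commutativeSemigroup using ()
    renaming (x∙yz≈y∙xz to x*yz≈y*xz)

  δ : ∀ {n} → Vec ℕ n → Vec ℕ n → A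
  δ f e with ≡-dec ℕ._≟_ f e
  ... | yes _ = 1#
  ... | no  _ = 0#

  δ-≢ : ∀ {n} {f e : Vec ℕ n} → f ≢ e → δ f e ≈ 0#
  δ-≢ {f = f} {e} f≢e with ≡-dec ℕ._≟_ f e
  ... | yes f≡e = contradiction f≡e f≢e
  ... | no  _   = refl

  δ-cong : ∀ {n m} {f e : Vec ℕ n} {f′ e′ : Vec ℕ m} →
           (f ≡ e → f′ ≡ e′) → (f′ ≡ e′ → f ≡ e) → δ f e ≈ δ f′ e′
  δ-cong {f = f} {e} {f′} {e′} to from with ≡-dec ℕ._≟_ f e | ≡-dec ℕ._≟_ f′ e′
  ... | yes _   | yes _    = refl
  ... | no  _   | no  _    = refl
  ... | yes f≡e | no  f′≢e′ = contradiction (to f≡e) f′≢e′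
  ... | no  f≢e | yes f′≡e′ = contradiction (from f′≡e′) f≢e

  _without_ : ∀ {n} → (Vec ℕ n → A) → Vec ℕ n → Vec ℕ n → A
  (Φ without g) f with ≡-dec ℕ._≟_ f g
  ... | yes _ = 0#
  ... | no  _ = Φ f

  -- Coefficients are pairings against δ (coeff≈pairing), and products and substitution unfold
  -- into nested pairings, so coefficient identities become rearrangements of finite sums.
  pairing : ∀ {n} → Poly K n → (Vec ℕ n → A) → A
  pairing [] Φ = 0#
  pairing ((a , f) ∷ L) Φ = a * Φ f + pairing L Φ

  module _ {n : ℕ} where

    pairing-cong : ∀ (L : Poly K n) {Φ Ψ} → (∀ f → Φ f ≈ Ψ f) → pairing L Φ ≈ pairing L Ψ
    pairing-cong [] _ = refl
    pairing-cong ((a , f) ∷ L) Φ≈Ψ = +-cong (*-congˡ (Φ≈Ψ f)) (pairing-cong L Φ≈Ψ)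

    pairing-zeroʳ : ∀ (L : Poly K n) → pairing L (λ _ → 0#) ≈ 0#
    pairing-zeroʳ [] = refl
    pairing-zeroʳ ((a , f) ∷ L) = trans (+-cong (zeroʳ a) (pairing-zeroʳ L)) (+-identityˡ 0#)

    pairing-+ : ∀ (L : Poly K n) Φ Ψ → pairing L (λ f → Φ f + Ψ f) ≈ pairing L Φ + pairing L Ψ
    pairing-+ [] Φ Ψ = sym (+-identityˡ 0#)
    pairing-+ ((a , f) ∷ L) Φ Ψ = begin
      a * (Φ f + Ψ f) + pairing L (λ f → Φ f + Ψ f) ≈⟨ +-cong (distribˡ a _ _) (pairing-+ L Φ Ψ) ⟩
      (a * Φ f + a * Ψ f) + (pairing L Φ + pairing L Ψ) ≈⟨ interchange _ _ _ _ ⟩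
      (a * Φ f + pairing L Φ) + (a * Ψ f + pairing L Ψ) ∎

    pairing-*ˡ : ∀ (L : Poly K n) x Φ → pairing L (λ f → x * Φ f) ≈ x * pairing L Φ
    pairing-*ˡ [] x Φ = sym (zeroʳ x)
    pairing-*ˡ ((a , f) ∷ L) x Φ = begin
      a * (x * Φ f) + pairing L (λ f → x * Φ f) ≈⟨ +-cong (x*yz≈y*xz a x (Φ f)) (pairing-*ˡ L x Φ) ⟩
      x * (a * Φ f) + x * pairing L Φ ≈⟨ distribˡ x _ _ ⟨
      x * (a * Φ f + pairing L Φ) ∎

    pairing-++ : ∀ (L M : Poly K n) Φ → pairing (L ++ M) Φ ≈ pairing L Φ + pairing M Φ
    pairing-++ [] M Φ = sym (+-identityˡ _)
    pairing-++ ((a , f) ∷ L) M Φ = trans (+-congˡ (pairing-++ L M Φ)) (sym (+-assoc _ _ _))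

    coeff≈pairing : ∀ (L : Poly K n) e → coeff K L e ≈ pairing L (λ f → δ f e)
    coeff≈pairing [] e = refl
    coeff≈pairing ((a , f) ∷ L) e with ≡-dec ℕ._≟_ f e
    ... | yes _ = +-cong (sym (*-identityʳ a)) (coeff≈pairing L e)
    ... | no  _ = trans (coeff≈pairing L e) (sym (trans (+-congʳ (zeroʳ a)) (+-identityˡ _)))

  pairing-comm : ∀ {n n′} (L : Poly K n) (M : Poly K n′) (Φ : Vec ℕ n → Vec ℕ n′ → A) →
                 pairing L (λ e → pairing M (Φ e)) ≈ pairing M (λ f → pairing L (λ e → Φ e f))
  pairing-comm [] M Φ = sym (pairing-zeroʳ M)
  pairing-comm ((a , e) ∷ L) M Φ = begin
    a * pairing M (Φ e) + pairing L (λ e → pairing M (Φ e))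
      ≈⟨ +-cong (sym (pairing-*ˡ M a (Φ e))) (pairing-comm L M Φ) ⟩
    pairing M (λ f → a * Φ e f) + pairing M (λ f → pairing L (λ e → Φ e f))
      ≈⟨ pairing-+ M _ _ ⟨
    pairing M (λ f → a * Φ e f + pairing L (λ e → Φ e f)) ∎

  module _ {n : ℕ} where

    coeff-∷-≢ : ∀ a f {e : Vec ℕ n} (L : Poly K n) → f ≢ e → coeff K ((a , f) ∷ L) e ≈ coeff K L e
    coeff-∷-≢ a f {e} L f≢e with ≡-dec ℕ._≟_ f e
    ... | yes f≡e = contradiction f≡e f≢e
    ... | no  _   = refl

    *-without≈0 : ∀ x (Φ : Vec ℕ n → A) {f g} → (f ≢ g → x * Φ f ≈ 0#) → x * (Φ without g) f ≈ 0#
    *-without≈0 x Φ {f} {g} h with ≡-dec ℕ._≟_ f g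
    ... | yes _   = zeroʳ x
    ... | no  f≢g = h f≢g

    pairing-split : ∀ (L : Poly K n) g Φ → pairing L Φ ≈ coeff K L g * Φ g + pairing L (Φ without g)
    pairing-split [] g Φ = sym (trans (+-congʳ (zeroˡ (Φ g))) (+-identityˡ 0#))
    pairing-split ((a , f) ∷ L) g Φ with ≡-dec ℕ._≟_ f g
    ... | yes ≡.refl = begin
      a * Φ f + pairing L Φ                                   ≈⟨ +-congˡ (pairing-split L f Φ) ⟩
      a * Φ f + (coeff K L f * Φ f + pairing L (Φ without f))  ≈⟨ +-assoc _ _ _ ⟨
      (a * Φ f + coeff K L f * Φ f) + pairing L (Φ without f)  ≈⟨ +-cong (distribʳ (Φ f) a _) (+-identityˡ _) ⟨
      (a + coeff K L f) * Φ f + (0# + pairing L (Φ without f)) ≈⟨ +-congˡ (+-congʳ (zeroʳ a)) ⟨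
      (a + coeff K L f) * Φ f + (a * 0# + pairing L (Φ without f)) ∎
    ... | no _ = begin
      a * Φ f + pairing L Φ                                   ≈⟨ +-congˡ (pairing-split L g Φ) ⟩
      a * Φ f + (coeff K L g * Φ g + pairing L (Φ without g))  ≈⟨ x∙yz≈y∙xz _ _ _ ⟩
      coeff K L g * Φ g + (a * Φ f + pairing L (Φ without g))  ∎

    pairing-vanishes : ∀ (L : Poly K n) Φ → (∀ f → coeff K L f * Φ f ≈ 0#) → pairing L Φ ≈ 0#
    pairing-vanishes [] Φ _ = refl
    pairing-vanishes ((a , g) ∷ L) Φ L·Φ≈0 = begin
      pairing ((a , g) ∷ L) Φ                                              ≈⟨ pairing-split ((a , g) ∷ L) g Φ ⟩
      coeff K ((a , g) ∷ L) g * Φ g + pairing ((a , g) ∷ L) (Φ without g)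
        ≈⟨ +-cong (L·Φ≈0 g) (+-cong (*-without≈0 a Φ {g} (contradiction ≡.refl))
                                    (pairing-vanishes L (Φ without g) L·Φ′≈0)) ⟩
      0# + (0# + 0#)                                   ≈⟨ trans (+-identityˡ _) (+-identityˡ _) ⟩
      0# ∎
      where
      L·Φ′≈0 : ∀ f → coeff K L f * (Φ without g) f ≈ 0#
      L·Φ′≈0 f = *-without≈0 _ Φ λ f≢g →
        trans (*-congʳ (sym (coeff-∷-≢ a g L (f≢g ∘ ≡.sym)))) (L·Φ≈0 f)

    pairing-concentrated : ∀ (L : Poly K n) g Φ → (∀ f → f ≢ g → coeff K L f * Φ f ≈ 0#) →
                           pairing L Φ ≈ coeff K L g * Φ g
    pairing-concentrated L g Φ off-g≈0 = begin
      pairing L Φ                                     ≈⟨ pairing-split L g Φ ⟩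
      coeff K L g * Φ g + pairing L (Φ without g)
        ≈⟨ +-congˡ (pairing-vanishes L _ λ f → *-without≈0 _ Φ (off-g≈0 f)) ⟩
      coeff K L g * Φ g + 0#                           ≈⟨ +-identityʳ _ ⟩
      coeff K L g * Φ g ∎

    pairing-monomial-*ₚ : ∀ a e (G : Poly K n) Φ →
      pairing (_*ₚ_ K ((a , e) ∷ []) G) Φ ≈ a * pairing G (λ f → Φ (e +ᵥ f))
    pairing-monomial-*ₚ a e [] Φ = sym (zeroʳ a)
    pairing-monomial-*ₚ a e ((b , f) ∷ G) Φ = begin
      a * b * Φ (e +ᵥ f) + pairing (_*ₚ_ K ((a , e) ∷ []) G) Φ
        ≈⟨ +-cong (*-assoc a b _) (pairing-monomial-*ₚ a e G Φ) ⟩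
      a * (b * Φ (e +ᵥ f)) + a * pairing G (λ f → Φ (e +ᵥ f)) ≈⟨ distribˡ a _ _ ⟨
      a * (b * Φ (e +ᵥ f) + pairing G (λ f → Φ (e +ᵥ f))) ∎

    *ₚ-∷ˡ : ∀ a e (F G : Poly K n) → _*ₚ_ K ((a , e) ∷ F) G ≡ _*ₚ_ K ((a , e) ∷ []) G ++ _*ₚ_ K F G
    *ₚ-∷ˡ a e F G = ≡.sym (++-assoc (map (λ (b , f) → (a * b , e +ᵥ f)) G) [] (_*ₚ_ K F G))

    pairing-*ₚ : ∀ (F G : Poly K n) Φ →
      pairing (_*ₚ_ K F G) Φ ≈ pairing F (λ e → pairing G (λ f → Φ (e +ᵥ f)))
    pairing-*ₚ [] G Φ = refl
    pairing-*ₚ ((a , e) ∷ F) G Φ = begin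
      pairing (_*ₚ_ K ((a , e) ∷ F) G) Φ
        ≡⟨ ≡.cong (λ X → pairing X Φ) (*ₚ-∷ˡ a e F G) ⟩
      pairing (_*ₚ_ K ((a , e) ∷ []) G ++ _*ₚ_ K F G) Φ
        ≈⟨ pairing-++ (_*ₚ_ K ((a , e) ∷ []) G) (_*ₚ_ K F G) Φ ⟩
      pairing (_*ₚ_ K ((a , e) ∷ []) G) Φ + pairing (_*ₚ_ K F G) Φ
        ≈⟨ +-cong (pairing-monomial-*ₚ a e G Φ) (pairing-*ₚ F G Φ) ⟩
      a * pairing G (λ f → Φ (e +ᵥ f)) + pairing F (λ e → pairing G (λ f → Φ (e +ᵥ f))) ∎

    pairing-oneₚ : ∀ Φ → pairing (oneₚ K {n}) Φ ≈ Φ (replicate n 0)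
    pairing-oneₚ Φ = trans (+-identityʳ _) (*-identityˡ _)

    *δ≈0 : ∀ x {f e : Vec ℕ n} → (f ≡ e → x ≈ 0#) → x * δ f e ≈ 0#
    *δ≈0 x {f} {e} h with ≡-dec ℕ._≟_ f e
    ... | yes f≡e = trans (*-identityʳ x) (h f≡e)
    ... | no  _   = zeroʳ x

    coeff-*ₚ : ∀ (F G : Poly K n) h →
               coeff K (_*ₚ_ K F G) h ≈ pairing F (λ e → pairing G (λ f → δ (e +ᵥ f) h))
    coeff-*ₚ F G h = trans (coeff≈pairing (_*ₚ_ K F G) h) (pairing-*ₚ F G _)

    *ₚ-zeroʳ : ∀ (F G : Poly K n) → _≈ₚ_ K G [] → _≈ₚ_ K (_*ₚ_ K F G) []
    *ₚ-zeroʳ F G G≈0 h = begin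
      coeff K (_*ₚ_ K F G) h                                  ≈⟨ coeff-*ₚ F G h ⟩
      pairing F (λ e → pairing G (λ f → δ (e +ᵥ f) h))
        ≈⟨ pairing-cong F (λ e → pairing-vanishes G _ λ f → trans (*-congʳ (G≈0 f)) (zeroˡ _)) ⟩
      pairing F (λ _ → 0#)                                     ≈⟨ pairing-zeroʳ F ⟩
      0# ∎

    coeff-*ₚ-leading : ∀ (F G : Poly K n) {eF eG} → (∀ {f} → eF <ₘ f → coeff K F f ≈ 0#) →
                  (∀ {g} → eG <ₘ g → coeff K G g ≈ 0#) →
                  coeff K (_*ₚ_ K F G) (eF +ᵥ eG) ≈ coeff K F eF * coeff K G eG
    coeff-*ₚ-leading F G {eF} {eG} F-above G-above = begin
      coeff K (_*ₚ_ K F G) (eF +ᵥ eG) ≈⟨ coeff-*ₚ F G _ ⟩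
      pairing F Φ                      ≈⟨ pairing-concentrated F eF Φ F·Φ≈0 ⟩
      coeff K F eF * Φ eF              ≈⟨ *-congˡ Φ-eF ⟩
      coeff K F eF * coeff K G eG ∎
      where
      Φ : Vec ℕ n → A
      Φ e = pairing G (λ g → δ (e +ᵥ g) (eF +ᵥ eG))

      Φ-eF : Φ eF ≈ coeff K G eG
      Φ-eF = trans (pairing-cong G λ g → δ-cong (+ᵥ-cancelˡ eF) (≡.cong (eF +ᵥ_)))
                   (sym (coeff≈pairing G eG))

      F·Φ≈0 : ∀ f → f ≢ eF → coeff K F f * Φ f ≈ 0#
      F·Φ≈0 f f≢eF with <ₘ-cmp f eF
      ... | tri< f<eF _ _ = trans (*-congˡ (pairing-vanishes G _ λ g →
                                    *δ≈0 _ λ f+g≡eF+eG → G-above (<ₘ-+ᵥ-cancel f<eF f+g≡eF+eG)))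
                                  (zeroʳ _)
      ... | tri≈ _ f≡eF _ = contradiction f≡eF f≢eF
      ... | tri> _ _ eF<f = trans (*-congʳ (F-above eF<f)) (zeroˡ _)

module Support {c ℓ} (K : CommutativeRing c ℓ) where

  open CommutativeRing K renaming (Carrier to A)
  open import Relation.Binary.Reasoning.Setoid setoid
  open Pairing K

  module _ {n : ℕ} where
    open import Data.List.Membership.DecPropositional (≡-dec {n = n} ℕ._≟_) using (_∈?_)
    open import Data.List.Relation.Unary.Unique.DecPropositional.Properties (≡-dec {n = n} ℕ._≟_)
      using (deduplicate-!)

    support : Poly K n → List (Vec ℕ n)
    support L = deduplicate (≡-dec ℕ._≟_) (map proj₂ L)

    coeff-∉support : ∀ (L : Poly K n) {e} → e ∉ support L → coeff K L e ≈ 0#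
    coeff-∉support L e∉ = coeff-∉ L (e∉ ∘ ∈-deduplicate⁺ (≡-dec ℕ._≟_))
      where
      coeff-∉ : ∀ (L : Poly K n) {e} → e ∉ map proj₂ L → coeff K L e ≈ 0#
      coeff-∉ [] _ = refl
      coeff-∉ ((a , f) ∷ L) e∉ =
        trans (coeff-∷-≢ a f L (λ f≡e → e∉ (here (≡.sym f≡e)))) (coeff-∉ L (e∉ ∘ there))

    coeff-scaleₚ : ∀ a (L : Poly K n) e → coeff K (scaleₚ K a L) e ≈ a * coeff K L e
    coeff-scaleₚ a [] e = sym (zeroʳ a)
    coeff-scaleₚ a ((b , f) ∷ L) e with ≡-dec ℕ._≟_ f e
    ... | yes _ = trans (+-congˡ (coeff-scaleₚ a L e)) (sym (distribˡ a b _))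
    ... | no  _ = coeff-scaleₚ a L e

    graph : (Vec ℕ n → A) → List (Vec ℕ n) → Poly K n
    graph φ = map (λ f → φ f , f)

    coeff-graph-∉ : ∀ φ S {e} → e ∉ S → coeff K (graph φ S) e ≈ 0#
    coeff-graph-∉ φ [] _ = refl
    coeff-graph-∉ φ (f ∷ S) e∉ = trans (coeff-∷-≢ (φ f) f (graph φ S) (λ f≡e → e∉ (here (≡.sym f≡e))))
                                       (coeff-graph-∉ φ S (e∉ ∘ there))

    coeff-graph-∈ : ∀ φ {S} → Unique S → ∀ {e} → e ∈ S → coeff K (graph φ S) e ≈ φ e
    coeff-graph-∈ φ {e ∷ S} (e∉S ∷ _) {e} (here ≡.refl) with ≡-dec ℕ._≟_ e e
    ... | yes _   = trans (+-congˡ (coeff-graph-∉ φ S (All¬⇒¬Any e∉S))) (+-identityʳ (φ e))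
    ... | no  e≢e = contradiction ≡.refl e≢e
    coeff-graph-∈ φ {f ∷ S} (f∉S ∷ S!) {e} (there e∈S) =
      trans (coeff-∷-≢ (φ f) f (graph φ S) (λ { ≡.refl → All¬⇒¬Any f∉S e∈S })) (coeff-graph-∈ φ S! e∈S)

    ∣ₚ⇒∣coeff : ∀ {a} (L : Poly K n) → _∣ₚ_ K a L → ∀ e → _∣R_ K a (coeff K L e)
    ∣ₚ⇒∣coeff {a} L (Q , L≈aQ) e = coeff K Q e , trans (L≈aQ e) (coeff-scaleₚ a Q e)

    ∣ₚ-from-coeff : ∀ {a} (L : Poly K n) → (∀ e → _∣R_ K a (coeff K L e)) → _∣ₚ_ K a L
    ∣ₚ-from-coeff {a} L a∣L =
      graph q (support L) , λ e → trans (coeff≈a*q e) (sym (coeff-scaleₚ a (graph q (support L)) e))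
      where
      q : Vec ℕ n → A
      q e = proj₁ (a∣L e)

      coeff≈a*q : ∀ e → coeff K L e ≈ a * coeff K (graph q (support L)) e
      coeff≈a*q e with e ∈? support L
      ... | yes e∈ = trans (proj₂ (a∣L e)) (*-congˡ (sym (coeff-graph-∈ q (deduplicate-! _) e∈)))
      ... | no  e∉ =
        trans (coeff-∉support L e∉) (sym (trans (*-congˡ (coeff-graph-∉ q _ e∉)) (zeroʳ a)))

    coeff≈0-from-support : ∀ (L : Poly K n) {e} → (e ∈ support L → coeff K L e ≈ 0#) →
                           coeff K L e ≈ 0#
    coeff≈0-from-support L {e} on-support with e ∈? support L
    ... | yes e∈ = on-support e∈
    ... | no  e∉ = coeff-∉support L e∉

    All⊎greatest-counterexample :
      ∀ {p} {Z : Vec ℕ n → Set p} S → All (Dec ∘ Z) S →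
      All Z S ⊎ ∃[ e ] (¬ Z e × (∀ {f} → f ∈ S → e <ₘ f → Z f))
    All⊎greatest-counterexample [] [] = inj₁ []
    All⊎greatest-counterexample (f ∷ S) (Z? ∷ S?) with All⊎greatest-counterexample S S? | Z?
    ... | inj₁ Z-S | yes Z-f = inj₁ (Z-f ∷ Z-S)
    ... | inj₁ Z-S | no ¬Z-f = inj₂ (f , ¬Z-f , λ { (here ≡.refl) f<f → ⊥-elim (<ₘ-irrefl f<f)
                                                  ; (there g∈S) _ → All.lookup Z-S g∈S })
    ... | inj₂ (e , ¬Z-e , above-e) | yes Z-f =
      inj₂ (e , ¬Z-e , λ { (here ≡.refl) _ → Z-f ; (there g∈S) → above-e g∈S })
    ... | inj₂ (e , ¬Z-e , above-e) | no ¬Z-f with <ₘ-cmp e f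
    ...   | tri< e<f _ _ = inj₂ (f , ¬Z-f , λ { (here ≡.refl) f<f → ⊥-elim (<ₘ-irrefl f<f)
                                            ; (there g∈S) f<g → above-e g∈S (<ₘ-trans e<f f<g) })
    ...   | tri≈ _ ≡.refl _ = inj₂ (e , ¬Z-e , λ { (here ≡.refl) e<e → ⊥-elim (<ₘ-irrefl e<e)
                                               ; (there g∈S) → above-e g∈S })
    ...   | tri> _ _ f<e = inj₂ (e , ¬Z-e , λ { (here ≡.refl) e<f → ⊥-elim (<ₘ-irrefl (<ₘ-trans e<f f<e))
                                            ; (there g∈S) → above-e g∈S })

    record IsLeading (L : Poly K n) (e : Vec ℕ n) : Set ℓ where
      field
        coeff≉0     : ¬ coeff K L e ≈ 0#
        coeff-above : ∀ {f} → e <ₘ f → coeff K L f ≈ 0#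

    leading : ∀ (L : Poly K n) → ¬ _≈ₚ_ K L [] → ¬ ¬ ∃ (IsLeading L)
    leading L L≉0 = do
      zero? ← All.sequenceM ℓ ¬¬-Monad (All.tabulate (λ _ → ¬¬-excluded-middle))
      case All⊎greatest-counterexample (support L) zero? of λ
        { (inj₁ all-zero) → ⊥-elim (L≉0 λ e → coeff≈0-from-support L (All.lookup all-zero))
        ; (inj₂ (e , e≉0 , above-e)) → pure (e , record
            { coeff≉0 = e≉0 ; coeff-above = λ e<f → coeff≈0-from-support L (λ f∈ → above-e f∈ e<f) }) }
      where open RawMonad (¬¬-Monad {ℓ})

module Substitution {c ℓ} (K : CommutativeRing c ℓ) where

  open CommutativeRing K renaming (Carrier to A) hiding (zero)
  open import Relation.Binary.Reasoning.Setoid setoid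
  open Pairing K

  module _ {n : ℕ} where

    high : Poly K (suc n) → Poly K (suc n)
    high [] = []
    high ((a , zero  ∷ e) ∷ P) = high P
    high ((a , suc k ∷ e) ∷ P) = (a , k ∷ e) ∷ high P

    raiseY : (Vec ℕ (suc n) → A) → Vec ℕ (suc n) → A
    raiseY Φ (zero  ∷ e) = 0#
    raiseY Φ (suc k ∷ e) = Φ (k ∷ e)

    pairing-high : ∀ (P : Poly K (suc n)) Φ → pairing (high P) Φ ≈ pairing P (raiseY Φ)
    pairing-high [] Φ = refl
    pairing-high ((a , zero  ∷ e) ∷ P) Φ =
      trans (pairing-high P Φ) (sym (trans (+-congʳ (zeroʳ a)) (+-identityˡ _)))
    pairing-high ((a , suc k ∷ e) ∷ P) Φ = +-congˡ (pairing-high P Φ)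

    coeff-high : ∀ (P : Poly K (suc n)) k e → coeff K (high P) (k ∷ e) ≈ coeff K P (suc k ∷ e)
    coeff-high P k e = begin
      coeff K (high P) (k ∷ e)                         ≈⟨ coeff≈pairing (high P) (k ∷ e) ⟩
      pairing (high P) (λ f → δ f (k ∷ e))             ≈⟨ pairing-high P _ ⟩
      pairing P (raiseY (λ f → δ f (k ∷ e)))           ≈⟨ pairing-cong P δ-raised ⟩
      pairing P (λ f → δ f (suc k ∷ e))                ≈⟨ coeff≈pairing P (suc k ∷ e) ⟨
      coeff K P (suc k ∷ e) ∎
      where
      δ-raised : ∀ f → raiseY (λ f → δ f (k ∷ e)) f ≈ δ f (suc k ∷ e)
      δ-raised (zero  ∷ f) = sym (δ-≢ {f = zero ∷ f} {suc k ∷ e} λ ())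
      δ-raised (suc j ∷ f) =
        δ-cong {f = j ∷ f} {k ∷ e} {suc j ∷ f} {suc k ∷ e} (λ { ≡.refl → ≡.refl }) (λ { ≡.refl → ≡.refl })

  module _ {n : ℕ} (m : Poly K n) where

    substWeight : (Vec ℕ n → A) → Vec ℕ (suc n) → A
    substWeight Ψ (k ∷ e) = pairing (_^ₚ_ K m k) (λ w → Ψ (e +ᵥ w))

    pairing-substY : ∀ (P : Poly K (suc n)) Ψ → pairing (substY K P m) Ψ ≈ pairing P (substWeight Ψ)
    pairing-substY [] Ψ = refl
    pairing-substY ((a , k ∷ e) ∷ P) Ψ = begin
      pairing (_*ₚ_ K ((a , e) ∷ []) (_^ₚ_ K m k) ++ substY K P m) Ψ
        ≈⟨ pairing-++ (_*ₚ_ K ((a , e) ∷ []) (_^ₚ_ K m k)) _ Ψ ⟩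
      pairing (_*ₚ_ K ((a , e) ∷ []) (_^ₚ_ K m k)) Ψ + pairing (substY K P m) Ψ
        ≈⟨ +-cong (pairing-monomial-*ₚ a e (_^ₚ_ K m k) Ψ) (pairing-substY P Ψ) ⟩
      a * substWeight Ψ (k ∷ e) + pairing P (substWeight Ψ) ∎

    coeff-substY : ∀ (P : Poly K (suc n)) h →
                   coeff K (substY K P m) h ≈ pairing P (substWeight (λ w → δ w h))
    coeff-substY P h = trans (coeff≈pairing (substY K P m) h) (pairing-substY P _)

    substY-zero : ∀ (P : Poly K (suc n)) → _≈ₚ_ K P [] → _≈ₚ_ K (substY K P m) []
    substY-zero P P≈0 h =
      trans (coeff-substY P h) (pairing-vanishes P _ λ f → trans (*-congʳ (P≈0 f)) (zeroˡ _))

    coeff-substY-horner : ∀ (P : Poly K (suc n)) h →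
      coeff K (substY K P m) h ≈ coeff K P (zero ∷ h) + coeff K (_*ₚ_ K m (substY K (high P) m)) h
    coeff-substY-horner P h = begin
      coeff K (substY K P m) h                            ≈⟨ coeff-substY P h ⟩
      pairing P (substWeight (λ w → δ w h))               ≈⟨ pairing-cong P y-expansion ⟩
      pairing P (λ f → δ f (zero ∷ h) + pairing m (λ u → Ψ u f)) ≈⟨ pairing-+ P _ _ ⟩
      pairing P (λ f → δ f (zero ∷ h)) + pairing P (λ f → pairing m (λ u → Ψ u f))
        ≈⟨ +-cong (coeff≈pairing P _) (pairing-comm m P Ψ) ⟨
      coeff K P (zero ∷ h) + pairing m (λ u → pairing P (Ψ u))
        ≈⟨ +-congˡ (pairing-cong m λ u → trans (pairing-substY (high P) _) (pairing-high P _)) ⟨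
      coeff K P (zero ∷ h) + pairing m (λ u → pairing (substY K (high P) m) (λ w → δ (u +ᵥ w) h))
        ≈⟨ +-congˡ (coeff-*ₚ m _ h) ⟨
      coeff K P (zero ∷ h) + coeff K (_*ₚ_ K m (substY K (high P) m)) h ∎
      where
      Ψ : Vec ℕ n → Vec ℕ (suc n) → A
      Ψ u = raiseY (substWeight (λ w → δ (u +ᵥ w) h))

      y-expansion : ∀ f → substWeight (λ w → δ w h) f ≈ δ f (zero ∷ h) + pairing m (λ u → Ψ u f)
      y-expansion (zero ∷ e) = begin
        pairing (oneₚ K) (λ w → δ (e +ᵥ w) h)           ≈⟨ pairing-oneₚ (λ w → δ (e +ᵥ w) h) ⟩
        δ (e +ᵥ replicate n 0) h                        ≡⟨ ≡.cong (λ x → δ x h) (+ᵥ-identityʳ e) ⟩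
        δ e h
          ≈⟨ δ-cong {f = e} {h} {zero ∷ e} {zero ∷ h} (≡.cong (zero ∷_)) (λ { ≡.refl → ≡.refl }) ⟩
        δ (zero ∷ e) (zero ∷ h)                         ≈⟨ +-identityʳ _ ⟨
        δ (zero ∷ e) (zero ∷ h) + 0#                    ≈⟨ +-congˡ (pairing-zeroʳ m) ⟨
        δ (zero ∷ e) (zero ∷ h) + pairing m (λ _ → 0#) ∎
      y-expansion (suc k ∷ e) = begin
        pairing (_*ₚ_ K m (_^ₚ_ K m k)) (λ w → δ (e +ᵥ w) h)
          ≈⟨ pairing-*ₚ m _ _ ⟩
        pairing m (λ u → pairing (_^ₚ_ K m k) (λ v → δ (e +ᵥ (u +ᵥ v)) h))
          ≈⟨ pairing-cong m (λ u → pairing-cong (_^ₚ_ K m k) λ v →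
               reflexive (≡.cong (λ x → δ x h) (+ᵥ-exchange e u v))) ⟩
        pairing m (λ u → Ψ u (suc k ∷ e))
          ≈⟨ +-identityˡ _ ⟨
        0# + pairing m (λ u → Ψ u (suc k ∷ e))
          ≈⟨ +-congʳ (δ-≢ {f = suc k ∷ e} {zero ∷ h} λ ()) ⟨
        δ (suc k ∷ e) (zero ∷ h) + pairing m (λ u → Ψ u (suc k ∷ e)) ∎

    ≈ₚ[]-from-high : ∀ (P : Poly K (suc n)) → _≈ₚ_ K (high P) [] → _≈ₚ_ K (substY K P m) [] →
                     _≈ₚ_ K P []
    ≈ₚ[]-from-high P high≈0 Pm≈0 (zero ∷ h) = begin
      coeff K P (zero ∷ h)                                              ≈⟨ +-identityʳ _ ⟨
      coeff K P (zero ∷ h) + 0#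
        ≈⟨ +-congˡ (*ₚ-zeroʳ m _ (substY-zero (high P) high≈0) h) ⟨
      coeff K P (zero ∷ h) + coeff K (_*ₚ_ K m (substY K (high P) m)) h ≈⟨ coeff-substY-horner P h ⟨
      coeff K (substY K P m) h                                          ≈⟨ Pm≈0 h ⟩
      0# ∎
    ≈ₚ[]-from-high P high≈0 _ (suc k ∷ e) = trans (sym (coeff-high P k e)) (high≈0 (k ∷ e))

module Vanishing {c ℓ} (K : CommutativeRing c ℓ) (K-domain : IsIntegralDomain K) where

  open CommutativeRing K renaming (Carrier to A) hiding (zero)
  open import Relation.Binary.Reasoning.Setoid setoid
  open Pairing K
  open Support K
  open Substitution K
  open IsIntegralDomain K-domain
  open RawMonad (¬¬-Monad {ℓ})

  module _ {n : ℕ} where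

    yDeg : A × Vec ℕ (suc n) → ℕ
    yDeg (_ , k ∷ _) = k

    yDeg-bound : ∀ (P : Poly K (suc n)) → ∃ λ B → All (λ t → yDeg t ℕ.< B) P
    yDeg-bound [] = 0 , []
    yDeg-bound (t ∷ P) with yDeg-bound P
    ... | B , P<B =
      suc (yDeg t) ℕ.⊔ B , ℕ.m≤m⊔n _ B ∷ All.map (λ k<B → ℕ.<-≤-trans k<B (ℕ.m≤n⊔m _ B)) P<B

    yDeg<-high : ∀ {B} (P : Poly K (suc n)) → All (λ t → yDeg t ℕ.< suc B) P →
                 All (λ t → yDeg t ℕ.< B) (high P)
    yDeg<-high [] [] = []
    yDeg<-high ((a , zero  ∷ e) ∷ P) (_ ∷ P<B) = yDeg<-high P P<B
    yDeg<-high ((a , suc k ∷ e) ∷ P) (ℕ.s≤s k<B ∷ P<B) = k<B ∷ yDeg<-high P P<B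

    degU<-high : ∀ {d} (P : Poly K (suc n)) → degU< K P d → degU< K (high P) d
    degU<-high P degP k e high≉0 = degP (suc k) e (high≉0 ∘ trans (coeff-high P k e))

  module _ {n : ℕ} {m : Poly K n} {eₘ : Vec ℕ n} (m-lead : IsLeading m eₘ)
           {d : ℕ} (d≤eₘ : d ℕ.≤ totalDeg eₘ) where
    open IsLeading

    -- If G = (high P)(u, m) ≉ 0 with leading exponent eG, the coefficient of P(u, m) at eₘ + eG
    -- is lc(m) · lc(G) ≉ 0, since P(u, 0) has no monomial of that degree.
    substY-high≈0 : ∀ (P : Poly K (suc n)) → degU< K P d → _≈ₚ_ K (substY K P m) [] →
                    ¬ ¬ _≈ₚ_ K (substY K (high P) m) []
    substY-high≈0 P degP Pm≈0 G≉0 = leading G G≉0 λ (eG , G-lead) → low≈0 eG λ P₀≈0 →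
      [ coeff≉0 m-lead , coeff≉0 G-lead ] (noZeroDiv _ _ (begin
        coeff K m eₘ * coeff K G eG         ≈⟨ coeff-*ₚ-leading m G (coeff-above m-lead) (coeff-above G-lead) ⟨
        coeff K (_*ₚ_ K m G) (eₘ +ᵥ eG)     ≈⟨ +-identityˡ _ ⟨
        0# + coeff K (_*ₚ_ K m G) (eₘ +ᵥ eG) ≈⟨ +-congʳ P₀≈0 ⟨
        coeff K P (zero ∷ (eₘ +ᵥ eG)) + coeff K (_*ₚ_ K m G) (eₘ +ᵥ eG)
                                              ≈⟨ coeff-substY-horner m P _ ⟨
        coeff K (substY K P m) (eₘ +ᵥ eG)    ≈⟨ Pm≈0 _ ⟩
        0# ∎))
      where
      G : Poly K n
      G = substY K (high P) m

      low≈0 : ∀ eG → ¬ ¬ coeff K P (zero ∷ (eₘ +ᵥ eG)) ≈ 0#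
      low≈0 eG P₀≉0 = ℕ.<⇒≱ (degP zero (eₘ +ᵥ eG) P₀≉0)
        (ℕ.≤-trans d≤eₘ (≡.subst (totalDeg eₘ ℕ.≤_) (≡.sym (totalDeg-+ᵥ eₘ eG)) (ℕ.m≤m+n _ _)))

    vanishing : ∀ B (P : Poly K (suc n)) → All (λ t → yDeg t ℕ.< B) P → degU< K P d →
                _≈ₚ_ K (substY K P m) [] → ¬ ¬ _≈ₚ_ K P []
    vanishing _ [] _ _ _ = pure λ _ → refl
    vanishing zero (_ ∷ _) (() ∷ _)
    vanishing (suc B) P P<B degP Pm≈0 = do
      G≈0 ← substY-high≈0 P degP Pm≈0
      high≈0 ← vanishing B (high P) (yDeg<-high P P<B) (degU<-high P degP) G≈0
      pure (≈ₚ[]-from-high m P high≈0 Pm≈0)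

  substY≈0⇒≈0 : ∀ {n} {m : Poly K n} {e} (P : Poly K (suc n)) → ¬ coeff K m e ≈ 0# →
                degU< K P (totalDeg e) → _≈ₚ_ K (substY K P m) [] → ¬ ¬ _≈ₚ_ K P []
  substY≈0⇒≈0 {m = m} {e} P m-e≉0 degP Pm≈0 = do
    eₘ , m-lead ← leading m (λ m≈0 → m-e≉0 (m≈0 e))
    let B , P<B = yDeg-bound P
    vanishing m-lead (≯ₘ⇒totalDeg≤ (m-e≉0 ∘ IsLeading.coeff-above m-lead)) B P P<B degP Pm≈0

module Quotient {c ℓ} (R : CommutativeRing c ℓ) (p : CommutativeRing.Carrier R) where

  open CommutativeRing R renaming (Carrier to A)
  open import Relation.Binary.Reasoning.Setoid setoid
  open import Algebra.Properties.Ring ring using (-‿distribʳ-*; x[y-z]≈xy-xz; [y-z]x≈yx-zx; -0#≈0#)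
  open import Algebra.Properties.AbelianGroup +-abelianGroup using (⁻¹-anti-homo‿-; ⁻¹-∙-comm)
  open import Algebra.Properties.CommutativeSemigroup +-commutativeSemigroup using (interchange)
  open import Algebra.Properties.CommutativeSemigroup *-commutativeSemigroup using (x∙yz≈y∙xz)

  infix 4 _∣_
  _∣_ : A → A → Set (c ⊔ ℓ)
  _∣_ = _∣R_ R

  ∣-resp : ∀ {x y} → x ≈ y → p ∣ x → p ∣ y
  ∣-resp x≈y (q , x≈pq) = q , trans (sym x≈y) x≈pq

  ∣-0# : p ∣ 0#
  ∣-0# = 0# , sym (zeroʳ p)

  ∣-+ : ∀ {x y} → p ∣ x → p ∣ y → p ∣ x + y
  ∣-+ (q , x≈pq) (q′ , y≈pq′) = q + q′ , trans (+-cong x≈pq y≈pq′) (sym (distribˡ p q q′))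

  ∣-*ˡ : ∀ a {x} → p ∣ x → p ∣ a * x
  ∣-*ˡ a (q , x≈pq) = a * q , trans (*-congˡ x≈pq) (x∙yz≈y∙xz a p q)

  ∣-*ʳ : ∀ a {x} → p ∣ x → p ∣ x * a
  ∣-*ʳ a p∣x = ∣-resp (*-comm a _) (∣-*ˡ a p∣x)

  ∣-‿ : ∀ {x} → p ∣ x → p ∣ - x
  ∣-‿ (q , x≈pq) = - q , trans (-‿cong x≈pq) (-‿distribʳ-* p q)

  infix 4 _≋_
  _≋_ : Rel A (c ⊔ ℓ)
  x ≋ y = p ∣ x - y

  ≈⇒≋ : ∀ {x y} → x ≈ y → x ≋ y
  ≈⇒≋ {x} {y} x≈y = ∣-resp (sym (trans (+-congʳ x≈y) (-‿inverseʳ y))) ∣-0#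

  ≋0⇒∣ : ∀ {x} → x ≋ 0# → p ∣ x
  ≋0⇒∣ = ∣-resp (trans (+-congˡ -0#≈0#) (+-identityʳ _))

  x-z≈[x-y]+[y-z] : ∀ x y z → x - z ≈ (x - y) + (y - z)
  x-z≈[x-y]+[y-z] x y z = begin
    x - z                   ≈⟨ +-congʳ (+-identityʳ x) ⟨
    (x + 0#) - z            ≈⟨ +-congʳ (+-congˡ (-‿inverseˡ y)) ⟨
    (x + (- y + y)) - z     ≈⟨ +-congʳ (+-assoc x (- y) y) ⟨
    ((x - y) + y) - z       ≈⟨ +-assoc (x - y) y (- z) ⟩
    (x - y) + (y - z)       ∎

  ≋-isEquivalence : IsEquivalence _≋_
  ≋-isEquivalence = record
    { refl  = ≈⇒≋ refl
    ; sym   = λ {x} {y} x≋y → ∣-resp (⁻¹-anti-homo‿- x y) (∣-‿ x≋y)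
    ; trans = λ {x} {y} {z} x≋y y≋z → ∣-resp (sym (x-z≈[x-y]+[y-z] x y z)) (∣-+ x≋y y≋z)
    }

  ≋-+-cong : ∀ {x y u v} → x ≋ y → u ≋ v → x + u ≋ y + v
  ≋-+-cong {x} {y} {u} {v} x≋y u≋v = ∣-resp (sym (begin
    (x + u) - (y + v)      ≈⟨ +-congˡ (⁻¹-∙-comm y v) ⟨
    (x + u) + (- y + - v)  ≈⟨ interchange x u (- y) (- v) ⟩
    (x - y) + (u - v)      ∎)) (∣-+ x≋y u≋v)

  ≋-*-cong : ∀ {x y u v} → x ≋ y → u ≋ v → x * u ≋ y * v
  ≋-*-cong {x} {y} {u} {v} x≋y u≋v = ∣-resp (sym (begin
    x * u - y * v                 ≈⟨ x-z≈[x-y]+[y-z] (x * u) (x * v) (y * v) ⟩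
    (x * u - x * v) + (x * v - y * v) ≈⟨ +-cong (x[y-z]≈xy-xz x u v) ([y-z]x≈yx-zx v x y) ⟨
    x * (u - v) + (x - y) * v     ∎)) (∣-+ (∣-*ˡ x u≋v) (∣-*ʳ v x≋y))

  ≋-‿-cong : ∀ {x y} → x ≋ y → - x ≋ - y
  ≋-‿-cong {x} {y} x≋y = ∣-resp (sym (⁻¹-∙-comm x (- y))) (∣-‿ x≋y)

  R/p : CommutativeRing c (c ⊔ ℓ)
  R/p = record
    { Carrier = A ; _≈_ = _≋_ ; _+_ = _+_ ; _*_ = _*_ ; -_ = -_ ; 0# = 0# ; 1# = 1#
    ; isCommutativeRing = record
      { isRing = record
        { +-isAbelianGroup = record
          { isGroup = record
            { isMonoid = record
              { isSemigroup = record
                { isMagma = record { isEquivalence = ≋-isEquivalence ; ∙-cong = ≋-+-cong }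
                ; assoc = λ x y z → ≈⇒≋ (+-assoc x y z) }
              ; identity = (λ x → ≈⇒≋ (+-identityˡ x)) , (λ x → ≈⇒≋ (+-identityʳ x)) }
            ; inverse = (λ x → ≈⇒≋ (-‿inverseˡ x)) , (λ x → ≈⇒≋ (-‿inverseʳ x))
            ; ⁻¹-cong = ≋-‿-cong }
          ; comm = λ x y → ≈⇒≋ (+-comm x y) }
        ; *-cong = ≋-*-cong
        ; *-assoc = λ x y z → ≈⇒≋ (*-assoc x y z)
        ; *-identity = (λ x → ≈⇒≋ (*-identityˡ x)) , (λ x → ≈⇒≋ (*-identityʳ x))
        ; distrib = (λ x y z → ≈⇒≋ (distribˡ x y z)) , (λ x y z → ≈⇒≋ (distribʳ x y z)) }
      ; *-comm = λ x y → ≈⇒≋ (*-comm x y) } }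

  ∣⇒≋0 : ∀ {x} → p ∣ x → x ≋ 0#
  ∣⇒≋0 = ∣-resp (sym (trans (+-congˡ -0#≈0#) (+-identityʳ _)))

  R/p-isIntegralDomain : IsPrimeElement R p → IsIntegralDomain R/p
  R/p-isIntegralDomain p-prime = record
    { 1≉0 = proper ∘ ≋0⇒∣
    ; noZeroDiv = λ x y xy≋0 → Sum.map ∣⇒≋0 ∣⇒≋0 (primeIdl x y (≋0⇒∣ xy≋0)) }
    where open IsPrimeElement p-prime

  coeff-R/p : ∀ {n} (L : Poly R n) e → coeff R/p L e ≡ coeff R L e
  coeff-R/p [] e = ≡.refl
  coeff-R/p ((a , f) ∷ L) e with ≡-dec ℕ._≟_ f e
  ... | yes _ = ≡.cong (a +_) (coeff-R/p L e)
  ... | no  _ = coeff-R/p L e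

  ^ₚ-R/p : ∀ {n} (m : Poly R n) k → _^ₚ_ R/p m k ≡ _^ₚ_ R m k
  ^ₚ-R/p m zero = ≡.refl
  ^ₚ-R/p m (suc k) = ≡.cong (_*ₚ_ R m) (^ₚ-R/p m k)

  substY-R/p : ∀ {n} (P : Poly R (suc n)) m → substY R/p P m ≡ substY R P m
  substY-R/p [] m = ≡.refl
  substY-R/p ((a , k ∷ e) ∷ P) m =
    ≡.cong₂ (λ M S → _*ₚ_ R ((a , e) ∷ []) M ++ S) (^ₚ-R/p m k) (substY-R/p P m)

  1≋0-if-both≋0 : ∀ {a b} → _∣R_ R a (b - 1#) → a ≋ 0# → b ≋ 0# → 1# ≋ 0#
  1≋0-if-both≋0 (q , b-1≈aq) a≋0 b≋0 = ≋.trans (≋.sym b≋1) b≋0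
    where
    module ≋ = IsEquivalence ≋-isEquivalence
    b≋1 = ∣-resp (sym b-1≈aq) (∣-*ʳ q (≋0⇒∣ a≋0))

lemma4p4 : ∀ {c ℓ} (R : CommutativeRing c ℓ) → IsIntegralDomain R →
    (p : CommutativeRing.Carrier R) → IsPrimeElement R p →
    (r : ℕ) → (P : Poly R (suc (suc r))) → ¬ (_∣ₚ_ R p P) →
    (m : Poly R (suc r)) → (e₁ e₂ : Vec ℕ (suc r)) → ¬ (e₁ ≡ e₂) →
    ¬ (CommutativeRing._≈_ R (coeff R m e₁) (CommutativeRing.0# R)) →
    ¬ (CommutativeRing._≈_ R (coeff R m e₂) (CommutativeRing.0# R)) →
    _∣R_ R (coeff R m e₁) (CommutativeRing._-_ R (coeff R m e₂) (CommutativeRing.1# R)) →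
    degU< R P (totalDeg e₁) → degU< R P (totalDeg e₂) →
    ¬ (_∣ₚ_ R p (substY R P m))
lemma4p4 R _ p p-prime r P p∤P m e₁ e₂ _ _ _ μ₁∣μ₂-1 deg₁ deg₂ p∣P[m] =
  μ₁-or-μ₂-survives λ { (inj₁ μ₁≉0) → absurd-if-survives μ₁≉0 deg₁ ; (inj₂ μ₂≉0) → absurd-if-survives μ₂≉0 deg₂ }
  where
  open CommutativeRing R using (0#)
  open Quotient R p
  open Support R using (∣ₚ⇒∣coeff; ∣ₚ-from-coeff)
  open IsIntegralDomain (R/p-isIntegralDomain p-prime) using (1≉0)
  open Vanishing R/p (R/p-isIntegralDomain p-prime) using (substY≈0⇒≈0)

  μ₁-or-μ₂-survives : ¬ ¬ (¬ coeff R m e₁ ≋ 0# ⊎ ¬ coeff R m e₂ ≋ 0#)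
  μ₁-or-μ₂-survives k = k (inj₁ λ μ₁≋0 → k (inj₂ λ μ₂≋0 →
    1≉0 (1≋0-if-both≋0 μ₁∣μ₂-1 μ₁≋0 μ₂≋0)))

  P[m]≋0 : _≈ₚ_ R/p (substY R/p P m) []
  P[m]≋0 h rewrite substY-R/p P m | coeff-R/p (substY R P m) h =
    ∣⇒≋0 (∣ₚ⇒∣coeff (substY R P m) p∣P[m] h)

  p∣P-if-P≋0 : _≈ₚ_ R/p P [] → _∣ₚ_ R p P
  p∣P-if-P≋0 P≋0 = ∣ₚ-from-coeff P λ e → ≋0⇒∣ (≡.subst (_≋ 0#) (coeff-R/p P e) (P≋0 e))

  degU<-mod-p : ∀ {d} → degU< R P d → degU< R/p P d
  degU<-mod-p degP k f P≉0 = degP k f (P≉0 ∘ ≡.subst (_≋ 0#) (≡.sym (coeff-R/p P (k ∷ f))) ∘ ≈⇒≋)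

  absurd-if-survives : ∀ {e} → ¬ coeff R m e ≋ 0# → degU< R P (totalDeg e) → ⊥
  absurd-if-survives {e} μ≉0 degP =
    substY≈0⇒≈0 P (μ≉0 ∘ ≡.subst (_≋ 0#) (coeff-R/p m e)) (degU<-mod-p degP) P[m]≋0 (p∤P ∘ p∣P-if-P≋0)
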